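{- Let $n,m$ be positive integers with $m\le\binom n2$. Then $N_{ind}(n,m,K_{1,2}\sqcup K_1)\le mn^2/8$.
   Context: $K_{1,2}\sqcup K_1$ is the disjoint union of a path with two edges and an isolated vertex. For a graph $H$, $N_{ind}(n,m,H)$ is the maximum, over all graphs $G$ with at most $n$ vertices and exactly $m$ edges, of the number of induced copies of $H$ in $G$. -}

module Defs where

open import Data.Nat using (ℕ; zero; suc; _+_; _*_; _≤_; _<_)
open import Data.Bool using (Bool; true; false; if_then_else_)
open import Data.Fin using (Fin; toℕ; zero; suc)
open import Data.Fin.Subset using (Subset; _∈_)
open import Data.List using (List; map; allFin)
open import Data.Nat.ListAction using (sum)
open import Data.Product using (∃; _×_)
open import Function.Definitions using (Injective)
open import Relation.Binary.PropositionalEquality using (_≡_)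
open import Relation.Nullary using (¬_)
open import Relation.Nullary.Decidable using (⌊_⌋)
open import Data.Fin using (_<?_)

record Graph (k : ℕ) : Set where
  field
    adj   : Fin k → Fin k → Bool
    sym   : ∀ i j → adj i j ≡ adj j i
    loopless : ∀ i → adj i i ≡ false
open Graph public

edgeCount : ∀ {k} → Graph k → ℕ
edgeCount {k} G =
  sum (map (λ i → sum (map (λ j → if ⌊ i <? j ⌋ then (if adj G i j then 1 else 0) else 0) (allFin k))) (allFin k))

P3+K1adj : Fin 4 → Fin 4 → Bool
P3+K1adj zero (suc zero) = true
P3+K1adj (suc zero) zero = true
P3+K1adj (suc zero) (suc (suc zero)) = true
P3+K1adj (suc (suc zero)) (suc zero) = true
P3+K1adj _ _ = false

P3+K1 : Graph 4
P3+K1 = record { adj = P3+K1adj ; sym = s ; loopless = l }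
  where
  s : ∀ i j → P3+K1adj i j ≡ P3+K1adj j i
  s zero zero = _≡_.refl
  s zero (suc zero) = _≡_.refl
  s zero (suc (suc zero)) = _≡_.refl
  s zero (suc (suc (suc zero))) = _≡_.refl
  s (suc zero) zero = _≡_.refl
  s (suc zero) (suc zero) = _≡_.refl
  s (suc zero) (suc (suc zero)) = _≡_.refl
  s (suc zero) (suc (suc (suc zero))) = _≡_.refl
  s (suc (suc zero)) zero = _≡_.refl
  s (suc (suc zero)) (suc zero) = _≡_.refl
  s (suc (suc zero)) (suc (suc zero)) = _≡_.refl
  s (suc (suc zero)) (suc (suc (suc zero))) = _≡_.refl
  s (suc (suc (suc zero))) zero = _≡_.refl
  s (suc (suc (suc zero))) (suc zero) = _≡_.refl
  s (suc (suc (suc zero))) (suc (suc zero)) = _≡_.refl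
  s (suc (suc (suc zero))) (suc (suc (suc zero))) = _≡_.refl
  l : ∀ i → P3+K1adj i i ≡ false
  l zero = _≡_.refl
  l (suc zero) = _≡_.refl
  l (suc (suc zero)) = _≡_.refl
  l (suc (suc (suc zero))) = _≡_.refl

InducesCopy : ∀ {k h} → Graph k → Graph h → Subset k → Set
InducesCopy {k} {h} G H S =
  ∃ λ (f : Fin h → Fin k) →
    Injective _≡_ _≡_ f
    × (∀ x → x ∈ S → ∃ λ i → f i ≡ x)
    × (∀ i → f i ∈ S)
    × (∀ i j → adj G (f i) (f j) ≡ adj H i j)

{-# OPTIONS --safe #-}
-- An induced copy of K_{1,2} ⊔ K_1, with path p q r and isolated vertex x,
-- yields two tags (a, b, w, x): ab is one of the path edges pq, qr (ordered so
-- that a < b), w is the third path vertex, adjacent to exactly one of a, b, and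
-- x is adjacent to neither. The vertices of a tag are those of its copy, so
-- distinct copies have distinct tags. For a fixed edge ab, the sets of
-- vertices adjacent to exactly one, resp. neither, of a, b are disjoint, so ab
-- carries at most their product ≤ (sum of their sizes)² / 4 ≤ n² / 4 tags;
-- summing over the m edges, twice the number of copies is at most m n² / 4.
module Submission where

open import Defs
open import Data.Nat using (ℕ; _*_; _≤_; _<_)
open import Data.Nat.Combinatorics using (_C_)
open import Data.Fin.Subset using (Subset)
open import Data.List using (List; length)
open import Data.List.Relation.Unary.All using (All)
open import Data.List.Relation.Unary.Unique.Propositional using (Unique)
open import Relation.Binary.PropositionalEquality using (_≡_)

open import Data.Bool using (Bool; true; false; not; _∨_; _xor_; if_then_else_; T)
open import Data.Bool.Properties using (∨-comm; T-≡)
open import Data.Fin using (Fin; _<?_) renaming (_<_ to _<ᶠ_)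
open import Data.Fin.Patterns using (0F; 1F; 2F; 3F)
open import Data.Fin.Properties using (<-cmp)
open import Data.Fin.Subset using () renaming (_∈_ to _∈ₛ_)
open import Data.Fin.Subset.Properties using (⊆-antisym)
open import Data.List using ([]; _∷_; _++_; map; concatMap; cartesianProductWith; filterᵇ; allFin)
open import Data.List.Membership.Propositional using (_∈_; lose)
open import Data.List.Membership.Propositional.Properties
  using (∈-allFin; ∈-map⁺; ∈-map⁻; ∈-filter⁺; ∈-concatMap⁺; ∈-cartesianProductWith⁺)
open import Data.List.Properties using (length-++; length-map; length-removeAt′; length-tabulate)
open import Data.List.Relation.Binary.Permutation.Propositional using (_↭_; ↭-refl; ↭-sym; ↭-trans; swap; prep)
open import Data.List.Relation.Binary.Permutation.Propositional.Properties using (∈-resp-↭)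
open import Data.List.Relation.Binary.Subset.Propositional using (_⊆_)
open import Data.List.Relation.Unary.All using ([]; _∷_)
import Data.List.Relation.Unary.All as All
open import Data.List.Relation.Unary.AllPairs using ([]; _∷_)
open import Data.List.Relation.Unary.Any using (here; there; index; _─_)
open import Data.Nat using (suc; _+_; z≤n; s≤s)
open import Data.Nat.ListAction using (sum)
open import Data.Nat.Properties
  using (≤-total; ≤-trans; ≤-reflexive; *-mono-≤; *-monoʳ-≤; +-mono-≤; m≤m+n; m≤n⇒∃[o]m+o≡n;
         *-comm; *-assoc; *-suc; +-suc; m≤n⇒m≤1+n; *-zeroʳ; *-identityʳ; +-comm; *-distribˡ-+; module ≤-Reasoning)
open import Data.Nat.Tactic.RingSolver using (solve-∀)
open import Data.Product using (∃; _×_; _,_; proj₁; proj₂)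
open import Data.Sum using (inj₁; inj₂)
open import Function using (id; _∘_; _⇔_; mk⇔; Equivalence)
open import Relation.Binary.Definitions using (tri<; tri≈; tri>)
open import Relation.Binary.PropositionalEquality using (refl; cong; cong₂; subst; subst₂; _≢_)
import Relation.Binary.PropositionalEquality as ≡
open import Relation.Nullary using (¬_; contradiction)
open import Relation.Nullary.Decidable using (⌊_⌋; T?; fromWitness)

module _ {A : Set} where

  ∈-─⁺ : ∀ {x y} {ys : List A} (x∈ys : x ∈ ys) → y ∈ ys → x ≢ y → y ∈ (ys ─ x∈ys)
  ∈-─⁺ (here refl) (here refl) x≢y = contradiction refl x≢y
  ∈-─⁺ (here _)    (there y∈ys) _  = y∈ys
  ∈-─⁺ (there _)   (here y≡z)   _  = here y≡z
  ∈-─⁺ (there x∈ys) (there y∈ys) x≢y = there (∈-─⁺ x∈ys y∈ys x≢y)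

  Unique-⊆⇒length≤ : ∀ {xs ys : List A} → Unique xs → xs ⊆ ys → length xs ≤ length ys
  Unique-⊆⇒length≤ {[]}     _          _     = z≤n
  Unique-⊆⇒length≤ {x ∷ xs} {ys} (x∉xs ∷ unique) xs⊆ys = begin
    suc (length xs)          ≤⟨ s≤s (Unique-⊆⇒length≤ unique xs⊆ys─x) ⟩
    suc (length (ys ─ x∈ys)) ≡⟨ length-removeAt′ ys (index x∈ys) ⟨
    length ys                ∎
    where
    open ≤-Reasoning
    x∈ys : x ∈ ys
    x∈ys = xs⊆ys (here refl)
    xs⊆ys─x : xs ⊆ (ys ─ x∈ys)
    xs⊆ys─x y∈xs = ∈-─⁺ x∈ys (xs⊆ys (there y∈xs)) (All.lookup x∉xs y∈xs)

  length-filterᵇ-disjoint : (p q : A → Bool) → (∀ x → T (p x) → ¬ T (q x)) →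
    ∀ xs → length (filterᵇ p xs) + length (filterᵇ q xs) ≤ length xs
  length-filterᵇ-disjoint p q disjoint [] = z≤n
  length-filterᵇ-disjoint p q disjoint (x ∷ xs)
    with p x | q x | disjoint x | length-filterᵇ-disjoint p q disjoint xs
  ... | true  | true  | both | _  = contradiction _ (both _)
  ... | true  | false | _    | ih = s≤s ih
  ... | false | true  | _    | ih = subst (_≤ suc (length xs)) (≡.sym (+-suc _ _)) (s≤s ih)
  ... | false | false | _    | ih = m≤n⇒m≤1+n ih

module DoubleCounting {A B : Set} {P : A → Set}
  (_determines_ : B → A → Set)
  (determines-functional : ∀ {t x y} → t determines x → t determines y → x ≡ y)
  (tag₁ tag₂ : ∀ {x} → P x → B)
  (tag₁-determines : ∀ {x} (p : P x) → tag₁ p determines x)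
  (tag₂-determines : ∀ {x} (p : P x) → tag₂ p determines x)
  (tag₁≢tag₂ : ∀ {x} (p : P x) → tag₁ p ≢ tag₂ p)
  where

  tagsOf : ∀ {xs} → All P xs → List B
  tagsOf []       = []
  tagsOf (p ∷ ps) = tag₁ p ∷ tag₂ p ∷ tagsOf ps

  length-tagsOf : ∀ {xs} (ps : All P xs) → length (tagsOf ps) ≡ 2 * length xs
  length-tagsOf []                = refl
  length-tagsOf {_ ∷ xs} (_ ∷ ps) = ≡.trans (cong (2 +_) (length-tagsOf ps)) (≡.sym (*-suc 2 (length xs)))

  tagsOf-⊆ : ∀ {xs ys} (ps : All P xs) →
    (∀ {x} (p : P x) → tag₁ p ∈ ys × tag₂ p ∈ ys) → tagsOf ps ⊆ ys
  tagsOf-⊆ (p ∷ ps) tags∈ys (here refl)         = proj₁ (tags∈ys p)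
  tagsOf-⊆ (p ∷ ps) tags∈ys (there (here refl)) = proj₂ (tags∈ys p)
  tagsOf-⊆ (p ∷ ps) tags∈ys (there (there t∈)) = tagsOf-⊆ ps tags∈ys t∈

  ∈-tagsOf⇒determines : ∀ {xs t} (ps : All P xs) → t ∈ tagsOf ps → ∃ λ x → x ∈ xs × t determines x
  ∈-tagsOf⇒determines (p ∷ ps) (here refl)         = _ , here refl , tag₁-determines p
  ∈-tagsOf⇒determines (p ∷ ps) (there (here refl)) = _ , here refl , tag₂-determines p
  ∈-tagsOf⇒determines (p ∷ ps) (there (there t∈)) with x , x∈xs , tdx ← ∈-tagsOf⇒determines ps t∈ =
    x , there x∈xs , tdx

  tagsOf-avoids : ∀ {x xs t} (ps : All P xs) → All (x ≢_) xs → t determines x → All (t ≢_) (tagsOf ps)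
  tagsOf-avoids ps x∉xs tdx = All.tabulate λ t′∈ t≡t′ →
    let y , y∈xs , t′dy = ∈-tagsOf⇒determines ps t′∈
    in All.lookup x∉xs y∈xs (determines-functional tdx (subst (_determines _) (≡.sym t≡t′) t′dy))

  tagsOf-unique : ∀ {xs} → Unique xs → (ps : All P xs) → Unique (tagsOf ps)
  tagsOf-unique []             []       = []
  tagsOf-unique (x∉xs ∷ unique) (p ∷ ps) =
    (tag₁≢tag₂ p ∷ tagsOf-avoids ps x∉xs (tag₁-determines p))
    ∷ tagsOf-avoids ps x∉xs (tag₂-determines p)
    ∷ tagsOf-unique unique ps

  2*length≤ : ∀ {xs ys} → Unique xs → (ps : All P xs) →
    (∀ {x} (p : P x) → tag₁ p ∈ ys × tag₂ p ∈ ys) → 2 * length xs ≤ length ys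
  2*length≤ {ys = ys} unique ps tags∈ys = subst (_≤ length ys) (length-tagsOf ps)
    (Unique-⊆⇒length≤ (tagsOf-unique unique ps) (tagsOf-⊆ ps tags∈ys))

length-cartesianProductWith : {A B C : Set} (f : A → B → C) (xs : List A) (ys : List B) →
  length (cartesianProductWith f xs ys) ≡ length xs * length ys
length-cartesianProductWith f []       ys = refl
length-cartesianProductWith f (x ∷ xs) ys = begin
  length (map (f x) ys ++ cartesianProductWith f xs ys)         ≡⟨ length-++ (map (f x) ys) ⟩
  length (map (f x) ys) + length (cartesianProductWith f xs ys) ≡⟨ cong₂ _+_ (length-map (f x) ys)
                                                                      (length-cartesianProductWith f xs ys) ⟩
  length ys + length xs * length ys                             ∎
  where open ≡.≡-Reasoning

*-length-concatMap-≤ : {A B : Set} (a b : ℕ) (f : A → List B) (g : A → ℕ) →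
  (∀ x → a * length (f x) ≤ b * g x) → ∀ xs → a * length (concatMap f xs) ≤ b * sum (map g xs)
*-length-concatMap-≤ a b f g bound [] =
  ≤-reflexive (≡.trans (*-zeroʳ a) (≡.sym (*-zeroʳ b)))
*-length-concatMap-≤ a b f g bound (x ∷ xs) = begin
  a * length (f x ++ concatMap f xs)              ≡⟨ cong (a *_) (length-++ (f x)) ⟩
  a * (length (f x) + length (concatMap f xs))    ≡⟨ *-distribˡ-+ a _ _ ⟩
  a * length (f x) + a * length (concatMap f xs)  ≤⟨ +-mono-≤ (bound x) (*-length-concatMap-≤ a b f g bound xs) ⟩
  b * g x + b * sum (map g xs)                    ≡⟨ *-distribˡ-+ b _ _ ⟨
  b * (g x + sum (map g xs))                      ∎
  where open ≤-Reasoning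

m≤n⇒4*m*n≤[m+n]² : ∀ {m n} → m ≤ n → 4 * (m * n) ≤ (m + n) * (m + n)
m≤n⇒4*m*n≤[m+n]² {m} m≤n with d , refl ← m≤n⇒∃[o]m+o≡n m≤n =
  ≤-trans (m≤m+n _ (d * d)) (≤-reflexive (≡.sym (square-identity m d)))
  where
  square-identity : ∀ m d → (m + (m + d)) * (m + (m + d)) ≡ 4 * (m * (m + d)) + d * d
  square-identity = solve-∀

4*m*n≤[m+n]² : ∀ m n → 4 * (m * n) ≤ (m + n) * (m + n)
4*m*n≤[m+n]² m n with ≤-total m n
... | inj₁ m≤n = m≤n⇒4*m*n≤[m+n]² m≤n
... | inj₂ n≤m = subst₂ (λ k l → 4 * k ≤ l * l) (*-comm n m) (+-comm n m) (m≤n⇒4*m*n≤[m+n]² n≤m)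

Tag : ℕ → Set
Tag k = Fin k × Fin k × Fin k × Fin k

vertices : ∀ {k} → Tag k → List (Fin k)
vertices (a , b , w , x) = a ∷ b ∷ w ∷ x ∷ []

offEdge : ∀ {k} → Tag k → Fin k
offEdge (_ , _ , w , _) = w

_spans_ : ∀ {k} → Tag k → Subset k → Set
t spans S = ∀ y → y ∈ₛ S ⇔ y ∈ vertices t

spans-functional : ∀ {k} {t : Tag k} {S S′ : Subset k} → t spans S → t spans S′ → S ≡ S′
spans-functional t⇔S t⇔S′ = ⊆-antisym (λ {y} → via (t⇔S y) (t⇔S′ y)) (λ {y} → via (t⇔S′ y) (t⇔S y))
  where
  via : ∀ {P Q R : Set} → P ⇔ R → Q ⇔ R → P → Q
  via P⇔R Q⇔R = Equivalence.from Q⇔R ∘ Equivalence.to P⇔R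

spans-resp-↭ : ∀ {k} {t t′ : Tag k} {S : Subset k} → vertices t ↭ vertices t′ → t spans S → t′ spans S
spans-resp-↭ t↭t′ t⇔S y = mk⇔ (∈-resp-↭ t↭t′ ∘ to) (from ∘ ∈-resp-↭ (↭-sym t↭t′))
  where open Equivalence (t⇔S y)

orient : ∀ {k} → Fin k → Fin k → Fin k → Fin k → Tag k
orient a b w x with <-cmp a b
... | tri> _ _ _ = (b , a , w , x)
... | _          = (a , b , w , x)

vertices-orient : ∀ {k} (a b w x : Fin k) → vertices (orient a b w x) ↭ vertices (a , b , w , x)
vertices-orient a b w x with <-cmp a b
... | tri< _ _ _ = ↭-refl
... | tri≈ _ _ _ = ↭-refl
... | tri> _ _ _ = swap b a ↭-refl

offEdge-orient : ∀ {k} (a b w x : Fin k) → offEdge (orient a b w x) ≡ w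
offEdge-orient a b w x with <-cmp a b
... | tri< _ _ _ = refl
... | tri≈ _ _ _ = refl
... | tri> _ _ _ = refl

module _ {k : ℕ} (G : Graph k) where

  separates : Fin k → Fin k → Fin k → Bool
  separates a b w = adj G w a xor adj G w b

  avoids : Fin k → Fin k → Fin k → Bool
  avoids a b x = not (adj G x a ∨ adj G x b)

  separates-sym : ∀ a b w → separates a b w ≡ separates b a w
  separates-sym a b w with adj G w a | adj G w b
  ... | true  | true  = refl
  ... | true  | false = refl
  ... | false | true  = refl
  ... | false | false = refl

  avoids-sym : ∀ a b x → avoids a b x ≡ avoids b a x
  avoids-sym a b x = cong not (∨-comm (adj G x a) (adj G x b))

  edgeTags : Fin k → Fin k → List (Tag k)
  edgeTags a b = cartesianProductWith (λ w x → a , b , w , x)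
    (filterᵇ (separates a b) (allFin k)) (filterᵇ (avoids a b) (allFin k))

  -- Shaped like the summand of edgeCount, so that the bound below compares them term by term.
  pairTags : Fin k → Fin k → List (Tag k)
  pairTags a b = if ⌊ a <? b ⌋ then (if adj G a b then edgeTags a b else []) else []

  tags : List (Tag k)
  tags = concatMap (λ a → concatMap (pairTags a) (allFin k)) (allFin k)

  4*length-edgeTags≤ : ∀ {n} → k ≤ n → ∀ a b → 4 * length (edgeTags a b) ≤ n * n * 1
  4*length-edgeTags≤ {n} k≤n a b = begin
    4 * length (edgeTags a b)  ≡⟨ cong (4 *_) (length-cartesianProductWith _ separators avoiders) ⟩
    4 * (∣S∣ * ∣A∣)            ≤⟨ 4*m*n≤[m+n]² ∣S∣ ∣A∣ ⟩
    (∣S∣ + ∣A∣) * (∣S∣ + ∣A∣)  ≤⟨ *-mono-≤ ∣S∣+∣A∣≤n ∣S∣+∣A∣≤n ⟩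
    n * n                      ≡⟨ *-identityʳ (n * n) ⟨
    n * n * 1                  ∎
    where
    open ≤-Reasoning
    separators avoiders : List (Fin k)
    separators = filterᵇ (separates a b) (allFin k)
    avoiders   = filterᵇ (avoids a b) (allFin k)
    ∣S∣ ∣A∣ : ℕ
    ∣S∣ = length separators
    ∣A∣ = length avoiders
    separates⇒¬avoids : ∀ y → T (separates a b y) → ¬ T (avoids a b y)
    separates⇒¬avoids y with adj G y a | adj G y b
    ... | true  | true  = λ ()
    ... | true  | false = λ _ ()
    ... | false | true  = λ _ ()
    ... | false | false = λ ()
    ∣S∣+∣A∣≤n : ∣S∣ + ∣A∣ ≤ n
    ∣S∣+∣A∣≤n = ≤-trans (length-filterᵇ-disjoint _ _ separates⇒¬avoids (allFin k))
                        (subst (_≤ n) (≡.sym (length-tabulate {n = k} id)) k≤n)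

  4*length-pairTags≤ : ∀ {n} → k ≤ n → ∀ a b →
    4 * length (pairTags a b) ≤ n * n * (if ⌊ a <? b ⌋ then (if adj G a b then 1 else 0) else 0)
  4*length-pairTags≤ k≤n a b with ⌊ a <? b ⌋ | adj G a b
  ... | true  | true  = 4*length-edgeTags≤ k≤n a b
  ... | true  | false = z≤n
  ... | false | _     = z≤n

  4*length-tags≤ : ∀ {n} → k ≤ n → 4 * length tags ≤ n * n * edgeCount G
  4*length-tags≤ {n} k≤n = *-length-concatMap-≤ 4 (n * n) _ _
    (λ a → *-length-concatMap-≤ 4 (n * n) _ _ (4*length-pairTags≤ k≤n a) (allFin k)) (allFin k)

  tags-∈ : ∀ {a b w x} → a <ᶠ b → adj G a b ≡ true → T (separates a b w) → T (avoids a b x) →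
    (a , b , w , x) ∈ tags
  tags-∈ {a} {b} {w} {x} a<b ab sep avo =
    ∈-concatMap⁺ _ (lose (∈-allFin a) (∈-concatMap⁺ (pairTags a) (lose (∈-allFin b) ∈-pairTags)))
    where
    ∈-edgeTags : (a , b , w , x) ∈ edgeTags a b
    ∈-edgeTags = ∈-cartesianProductWith⁺ _
      (∈-filter⁺ (T? ∘ separates a b) (∈-allFin w) sep) (∈-filter⁺ (T? ∘ avoids a b) (∈-allFin x) avo)
    a<ᵇb : ⌊ a <? b ⌋ ≡ true
    a<ᵇb = Equivalence.to T-≡ (fromWitness {a? = a <? b} a<b)
    ∈-pairTags : (a , b , w , x) ∈ pairTags a b
    ∈-pairTags = subst ((a , b , w , x) ∈_)
      (cong₂ (λ p q → if p then (if q then edgeTags a b else []) else []) (≡.sym a<ᵇb) (≡.sym ab))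
      ∈-edgeTags

  orient-∈-tags : ∀ {a b w x} → adj G a b ≡ true → T (separates a b w) → T (avoids a b x) →
    orient a b w x ∈ tags
  orient-∈-tags {a} {b} {w} {x} ab sep avo with <-cmp a b
  ... | tri< a<b _ _ = tags-∈ a<b ab sep avo
  ... | tri≈ _ refl _ = contradiction (≡.trans (≡.sym ab) (loopless G a)) λ ()
  ... | tri> _ _ b<a = tags-∈ b<a (≡.trans (Graph.sym G b a) ab)
    (subst T (separates-sym a b w) sep) (subst T (avoids-sym a b x) avo)

  Copy : Subset k → Set
  Copy = InducesCopy G P3+K1

  imageTag tag₁ tag₂ : ∀ {S} → Copy S → Tag k
  imageTag (f , _) = f 0F , f 1F , f 2F , f 3F
  tag₁     (f , _) = orient (f 0F) (f 1F) (f 2F) (f 3F)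
  tag₂     (f , _) = orient (f 1F) (f 2F) (f 0F) (f 3F)

  imageTag-spans : ∀ {S} (c : Copy S) → imageTag c spans S
  imageTag-spans {S} (f , _ , onto , into , _) y = mk⇔ to from
    where
    -- vertices (imageTag (f , …)) computes to map f (allFin 4).
    to : y ∈ₛ S → y ∈ map f (allFin 4)
    to y∈S with i , refl ← onto y y∈S = ∈-map⁺ f (∈-allFin i)
    from : y ∈ map f (allFin 4) → y ∈ₛ S
    from y∈f[4] with i , _ , refl ← ∈-map⁻ f y∈f[4] = into i

  tag₁-spans : ∀ {S} (c : Copy S) → tag₁ c spans S
  tag₁-spans c@(f , _) = spans-resp-↭ (↭-sym (vertices-orient (f 0F) (f 1F) (f 2F) (f 3F))) (imageTag-spans c)

  tag₂-spans : ∀ {S} (c : Copy S) → tag₂ c spans S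
  tag₂-spans c@(f , _) = spans-resp-↭
    (↭-trans (↭-trans (swap (f 0F) (f 1F) ↭-refl) (prep (f 1F) (swap (f 0F) (f 2F) ↭-refl)))
             (↭-sym (vertices-orient (f 1F) (f 2F) (f 0F) (f 3F))))
    (imageTag-spans c)

  tag₁≢tag₂ : ∀ {S} (c : Copy S) → tag₁ c ≢ tag₂ c
  tag₁≢tag₂ c@(f , injective , _) tag₁≡tag₂ = contradiction (injective f₂≡f₀) λ ()
    where
    f₂≡f₀ : f 2F ≡ f 0F
    f₂≡f₀ = begin
      f 2F              ≡⟨ offEdge-orient (f 0F) (f 1F) (f 2F) (f 3F) ⟨
      offEdge (tag₁ c)  ≡⟨ cong offEdge tag₁≡tag₂ ⟩
      offEdge (tag₂ c)  ≡⟨ offEdge-orient (f 1F) (f 2F) (f 0F) (f 3F) ⟩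
      f 0F              ∎
      where open ≡.≡-Reasoning

  tag₁-∈ : ∀ {S} (c : Copy S) → tag₁ c ∈ tags
  tag₁-∈ (f , _ , _ , _ , induced) = orient-∈-tags (induced 0F 1F) separated avoided
    where
    separated : T (separates (f 0F) (f 1F) (f 2F))
    separated rewrite induced 2F 0F | induced 2F 1F = _
    avoided : T (avoids (f 0F) (f 1F) (f 3F))
    avoided rewrite induced 3F 0F | induced 3F 1F = _

  tag₂-∈ : ∀ {S} (c : Copy S) → tag₂ c ∈ tags
  tag₂-∈ (f , _ , _ , _ , induced) = orient-∈-tags (induced 1F 2F) separated avoided
    where
    separated : T (separates (f 1F) (f 2F) (f 0F))
    separated rewrite induced 0F 1F | induced 0F 2F = _
    avoided : T (avoids (f 1F) (f 2F) (f 3F))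
    avoided rewrite induced 3F 1F | induced 3F 2F = _

  2*length≤length-tags : ∀ {copies} → Unique copies → All Copy copies → 2 * length copies ≤ length tags
  2*length≤length-tags unique copies =
    DoubleCounting.2*length≤ _spans_ spans-functional tag₁ tag₂ tag₁-spans tag₂-spans tag₁≢tag₂
      unique copies (λ c → tag₁-∈ c , tag₂-∈ c)

-- The bound holds without the hypotheses 0 < n, 0 < m and m ≤ n C 2.
mainTheorem13 : (n m : ℕ) → 0 < n → 0 < m → m ≤ n C 2 →
    (k : ℕ) → k ≤ n → (G : Graph k) → edgeCount G ≡ m →
    (copies : List (Subset k)) → Unique copies → All (InducesCopy G P3+K1) copies →
    8 * length copies ≤ m * (n * n)
mainTheorem13 n _ _ _ _ k k≤n G refl copies unique induced = begin
  8 * length copies        ≡⟨ *-assoc 4 2 (length copies) ⟩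
  4 * (2 * length copies)  ≤⟨ *-monoʳ-≤ 4 (2*length≤length-tags G unique induced) ⟩
  4 * length (tags G)      ≤⟨ 4*length-tags≤ G k≤n ⟩
  n * n * edgeCount G      ≡⟨ *-comm (n * n) (edgeCount G) ⟩
  edgeCount G * (n * n)    ∎
  where open ≤-Reasoning
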